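{- For every SPS $s$ over $\mathcal P$, $s$ is satisfiable (i.e. some schema interpretation $(\sigma,m)$ satisfies $\sigma\models\langle s\rangle_m$) if and only if the LTL formula $\lfloor s\rfloor$ is satisfiable.
   Context: Schemata: $s::=\top\mid p_e\mid\neg s\mid s\wedge s\mid\bigwedge_{\mathsf i=0}^{\mathsf n-1}s$ with Presburger indices and single parameter $\mathsf n$; instance $\langle s\rangle_m$: $\langle p_e\rangle_m=p_{e[m/\mathsf n]}$, commutes with $\neg,\wedge$, $\langle\bigwedge_{\mathsf i=0}^{\mathsf n-1}s\rangle_m=\top$ if $m=0$ and $\bigwedge_{j=0}^{m-1}\langle s[j/\mathsf i]\rangle_m$ otherwise; $\sigma:\mathcal P\times\mathbb N\to\{\mathrm{true},\mathrm{false}\}$ and $\sigma\models p_k$ iff $\sigma(p,k)$ is true. An SPS is a schema with no nested iterations, indices outside iterations of the form $k$ or $\mathsf n+k$, and indices inside an iteration of the form $\mathsf i+k$ ($k\in\mathbb N$). LTL: $\phi::=\top\mid p\mid\neg\phi\mid\phi\wedge\phi\mid X\phi\mid\phi U\phi$ with the standard semantics over interpretations $\sigma:\mathcal P\times\mathbb N\to\{\mathrm{true},\mathrm{false}\}$ ($\sigma,t\models X\phi$ iff $\sigma,t+1\models\phi$; $\sigma,t\models\phi_1U\phi_2$ iff $\exists k$, $\sigma,t+k\models\phi_2$ and $\sigma,t+i\models\phi_1$ for $i<k$); satisfiable means true at time $0$ in some interpretation. $G\phi:=\neg(\top U\neg\phi)$, $X^k$ is $k$-fold $X$. Translation: with fresh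 variables $a,b$: $\lfloor\top\rfloor_{\mathrm{prop}}=\top$, $\lfloor p_k\rfloor_{\mathrm{prop}}=X^kp$, $\lfloor p_{\mathsf n+k}\rfloor_{\mathrm{prop}}=G(b\Rightarrow X^kp)$, $\lfloor p_{\mathsf i+k}\rfloor_{\mathrm{prop}}=X^kp$ ($\mathsf i\ne\mathsf n$), $\lfloor\neg s\rfloor_{\mathrm{prop}}=\neg\lfloor s\rfloor_{\mathrm{prop}}$, $\lfloor s_1\wedge s_2\rfloor_{\mathrm{prop}}=\lfloor s_1\rfloor_{\mathrm{prop}}\wedge\lfloor s_2\rfloor_{\mathrm{prop}}$, $\lfloor\bigwedge_{\mathsf i=0}^{\mathsf n-1}s\rfloor_{\mathrm{prop}}=G(a\Rightarrow\lfloor s\rfloor_{\mathrm{prop}})$; and $\lfloor s\rfloor=\lfloor s\rfloor_{\mathrm{prop}}\wedge(a\,U\,G\neg a)\wedge G((a\wedge\neg Xa)\Leftrightarrow Xb)\wedge(\neg a\Leftrightarrow b)$. -}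

module Defs where

open import Data.Nat using (ℕ; zero; suc; _+_)
open import Data.Fin using (Fin)
open import Data.Bool using (Bool; true)
open import Data.List using (List; []; _∷_; map; upTo)
open import Data.Product using (Σ; _×_; ∃)
open import Data.Unit using (⊤)
open import Data.Empty using (⊥)
open import Relation.Nullary using (¬_)
open import Relation.Binary.PropositionalEquality using (_≡_)

data PForm (P : Set) : Set where
  ⊤ᵖ   : PForm P
  atm  : P → ℕ → PForm P
  ¬ᵖ_  : PForm P → PForm P
  _∧ᵖ_ : PForm P → PForm P → PForm P

-- conjunction of a list of formulas (only used on non-empty lists)
bigAnd : {P : Set} → List (PForm P) → PForm P
bigAnd []           = ⊤ᵖ
bigAnd (x ∷ [])     = x
bigAnd (x ∷ y ∷ xs) = x ∧ᵖ bigAnd (y ∷ xs)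

_⊨ᵖ_ : {P : Set} → (P → ℕ → Bool) → PForm P → Set
σ ⊨ᵖ ⊤ᵖ       = ⊤
σ ⊨ᵖ atm p k  = σ p k ≡ true
σ ⊨ᵖ (¬ᵖ φ)   = ¬ (σ ⊨ᵖ φ)
σ ⊨ᵖ (φ ∧ᵖ ψ) = (σ ⊨ᵖ φ) × (σ ⊨ᵖ ψ)

-- Index expressions are Presburger terms built from
-- constants, the parameter n and bound (iteration) variables, the latter
-- in de Bruijn style: a term in `Idx d` may use d bound variables.

data Idx (d : ℕ) : Set where
  lit  : ℕ → Idx d
  par  : Idx d
  var  : Fin d → Idx d
  _⊕_  : Idx d → Idx d → Idx d

data Schema (P : Set) : ℕ → Set where
  ⊤ˢ    : ∀ {d} → Schema P d
  prop  : ∀ {d} → P → Idx d → Schema P d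
  ¬ˢ_   : ∀ {d} → Schema P d → Schema P d
  _∧ˢ_  : ∀ {d} → Schema P d → Schema P d → Schema P d
  iter  : ∀ {d} → Schema P (suc d) → Schema P d          -- ⋀_{i=0}^{n-1} s

evalIdx : ∀ {d} → ℕ → (Fin d → ℕ) → Idx d → ℕ
evalIdx m ρ (lit k)   = k
evalIdx m ρ par       = m
evalIdx m ρ (var x)   = ρ x
evalIdx m ρ (e ⊕ e')  = evalIdx m ρ e + evalIdx m ρ e'

extend : ∀ {d} → ℕ → (Fin d → ℕ) → Fin (suc d) → ℕ
extend j ρ Fin.zero    = j
extend j ρ (Fin.suc x) = ρ x

inst : ∀ {P d} → Schema P d → ℕ → (Fin d → ℕ) → PForm P
inst ⊤ˢ          m ρ = ⊤ᵖ
inst (prop p e)  m ρ = atm p (evalIdx m ρ e)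
inst (¬ˢ s)      m ρ = ¬ᵖ inst s m ρ
inst (s ∧ˢ s')   m ρ = inst s m ρ ∧ᵖ inst s' m ρ
inst (iter s)    zero    ρ = ⊤ᵖ
inst (iter s)    (suc m) ρ =
  bigAnd (map (λ j → inst s (suc m) (extend j ρ)) (upTo (suc m)))

noVars : Fin 0 → ℕ
noVars ()

⟨_⟩_ : ∀ {P} → Schema P 0 → ℕ → PForm P
⟨ s ⟩ m = inst s m noVars

SchemaSatisfiable : ∀ {P} → Schema P 0 → Set
SchemaSatisfiable {P} s = Σ (P → ℕ → Bool) λ σ → Σ ℕ λ m → σ ⊨ᵖ (⟨ s ⟩ m)

-- Simple parameterized schemata (SPS): no nested iterations; outside
-- iterations indices are k or n+k; inside an iteration indices are i+k.

data SPSBody (P : Set) : Set where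
  ⊤ᵇ    : SPSBody P
  propI : P → ℕ → SPSBody P
  ¬ᵇ_   : SPSBody P → SPSBody P
  _∧ᵇ_  : SPSBody P → SPSBody P → SPSBody P

data SPS (P : Set) : Set where
  ⊤ˢᵖ   : SPS P
  propK : P → ℕ → SPS P
  propN : P → ℕ → SPS P
  ¬ˢᵖ_  : SPS P → SPS P
  _∧ˢᵖ_ : SPS P → SPS P → SPS P
  bigIt : SPSBody P → SPS P

bodyToSchema : ∀ {P} → SPSBody P → Schema P 1
bodyToSchema ⊤ᵇ          = ⊤ˢ
bodyToSchema (propI p k) = prop p (var Fin.zero ⊕ lit k)
bodyToSchema (¬ᵇ s)      = ¬ˢ bodyToSchema s
bodyToSchema (s ∧ᵇ t)    = bodyToSchema s ∧ˢ bodyToSchema t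

toSchema : ∀ {P} → SPS P → Schema P 0
toSchema ⊤ˢᵖ         = ⊤ˢ
toSchema (propK p k) = prop p (lit k)
toSchema (propN p k) = prop p (par ⊕ lit k)
toSchema (¬ˢᵖ s)     = ¬ˢ toSchema s
toSchema (s ∧ˢᵖ t)   = toSchema s ∧ˢ toSchema t
toSchema (bigIt s)   = iter (bodyToSchema s)

data LTL (A : Set) : Set where
  ⊤ˡ   : LTL A
  var  : A → LTL A
  ¬ˡ_  : LTL A → LTL A
  _∧ˡ_ : LTL A → LTL A → LTL A
  X    : LTL A → LTL A
  _U_  : LTL A → LTL A → LTL A

_⊨ˡ_at_ : ∀ {A} → (A → ℕ → Bool) → LTL A → ℕ → Set
σ ⊨ˡ ⊤ˡ       at t = ⊤
σ ⊨ˡ var p    at t = σ p t ≡ true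
σ ⊨ˡ (¬ˡ φ)   at t = ¬ (σ ⊨ˡ φ at t)
σ ⊨ˡ (φ ∧ˡ ψ) at t = (σ ⊨ˡ φ at t) × (σ ⊨ˡ ψ at t)
σ ⊨ˡ X φ      at t = σ ⊨ˡ φ at (suc t)
σ ⊨ˡ (φ U ψ)  at t =
  Σ ℕ λ k → (σ ⊨ˡ ψ at (t + k)) × ((i : ℕ) → i Data.Nat.< k → σ ⊨ˡ φ at (t + i))

LTLSatisfiable : ∀ {A} → LTL A → Set
LTLSatisfiable {A} φ = Σ (A → ℕ → Bool) λ σ → σ ⊨ˡ φ at 0

G : ∀ {A} → LTL A → LTL A
G φ = ¬ˡ (⊤ˡ U (¬ˡ φ))

Xs : ∀ {A} → ℕ → LTL A → LTL A
Xs zero    φ = φ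
Xs (suc k) φ = X (Xs k φ)

_⇒ˡ_ : ∀ {A} → LTL A → LTL A → LTL A
φ ⇒ˡ ψ = ¬ˡ (φ ∧ˡ (¬ˡ ψ))

_⇔ˡ_ : ∀ {A} → LTL A → LTL A → LTL A
φ ⇔ˡ ψ = (φ ⇒ˡ ψ) ∧ˡ (ψ ⇒ˡ φ)

data Atom (P : Set) : Set where
  orig : P → Atom P
  a    : Atom P
  b    : Atom P

trBody : ∀ {P} → SPSBody P → LTL (Atom P)
trBody ⊤ᵇ          = ⊤ˡ
trBody (propI p k) = Xs k (var (orig p))
trBody (¬ᵇ s)      = ¬ˡ trBody s
trBody (s ∧ᵇ t)    = trBody s ∧ˡ trBody t

trProp : ∀ {P} → SPS P → LTL (Atom P)
trProp ⊤ˢᵖ         = ⊤ˡ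
trProp (propK p k) = Xs k (var (orig p))
trProp (propN p k) = G (var b ⇒ˡ Xs k (var (orig p)))
trProp (¬ˢᵖ s)     = ¬ˡ trProp s
trProp (s ∧ˢᵖ t)   = trProp s ∧ˡ trProp t
trProp (bigIt s)   = G (var a ⇒ˡ trBody s)

⌊_⌋ : ∀ {P} → SPS P → LTL (Atom P)
⌊ s ⌋ = trProp s
     ∧ˡ ((var a U G (¬ˡ var a))
     ∧ˡ (G ((var a ∧ˡ (¬ˡ X (var a))) ⇔ˡ X (var b))
     ∧ˡ ((¬ˡ var a) ⇔ˡ var b)))

-- The conjunct `clock` of ⌊ s ⌋ holds in σ exactly when, for some m, the fresh atom a
-- holds at the instants before m and b holds exactly at m (Marks σ m).  Under such a
-- marking trProp s says at time 0 what ⟨ s ⟩ m says about the original variables: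
-- G (b ⇒ Xᵏ p) reads p at m + k, and G (a ⇒ body) ranges the body over the j < m.
-- Atoms are Boolean, so every formula under a G is decidable; this is what lets
-- G and ⇒ be read classically in a constructive metatheory.
module Submission where

open import Defs
open import Data.Bool using (Bool; true)
import Data.Bool.Properties as Bool
open import Data.List using (List; []; _∷_; map; upTo)
open import Data.List.Relation.Unary.All using (All; []; _∷_)
import Data.List.Relation.Unary.All as All
open import Data.List.Relation.Unary.All.Properties using (map⁺; map⁻; applyUpTo⁺₁; applyUpTo⁻)
open import Data.Nat using (ℕ; zero; suc; _+_; _∸_; _<_; _≮_; _<?_; _≟_)
open import Data.Nat.Properties
  using (+-identityʳ; +-suc; ≤-antisym; ≮⇒≥; <-irrefl; n<1+n; n≤0⇒n≡0; m+n≮m; m+[n∸m]≡n)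
open import Data.Product using (Σ; _×_; _,_; proj₁; proj₂; uncurry)
open import Data.Product.Function.NonDependent.Propositional using (_×-⇔_)
open import Data.Unit using (tt)
open import Function using (_∘_; id)
open import Function.Bundles using (_⇔_; mk⇔; Equivalence)
open import Function.Properties.Equivalence
  using () renaming (refl to ⇔-refl; sym to ⇔-sym; trans to ⇔-trans)
open import Function.Related.Propositional using (module EquationalReasoning; equivalence)
open import Function.Related.TypeIsomorphisms using (→-cong-⇔; ¬-cong-⇔)
open import Relation.Nullary using (¬_; Dec; yes; no; does; ¬?; _×-dec_)
import Relation.Nullary.Decidable as Dec
open import Relation.Nullary.Decidable using (decidable-stable)
open import Relation.Nullary.Negation using (Stable; negated-stable; contradiction)
open import Relation.Binary.PropositionalEquality using (_≡_; refl; subst)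
import Relation.Binary.PropositionalEquality as ≡

open Equivalence using (to; from)
open EquationalReasoning {k = equivalence}

Π-cong-⇔ : {I : Set} {A B : I → Set} → (∀ i → A i ⇔ B i) → ((i : I) → A i) ⇔ ((i : I) → B i)
Π-cong-⇔ A⇔B = mk⇔ (λ f i → to (A⇔B i) (f i)) (λ g i → from (A⇔B i) (g i))

⇔-cong : {A A′ B B′ : Set} → A ⇔ A′ → B ⇔ B′ → (A ⇔ B) ⇔ (A′ ⇔ B′)
⇔-cong A⇔A′ B⇔B′ =
  mk⇔ (λ A⇔B → ⇔-trans (⇔-sym A⇔A′) (⇔-trans A⇔B B⇔B′))
      (λ A′⇔B′ → ⇔-trans A⇔A′ (⇔-trans A′⇔B′ (⇔-sym B⇔B′)))

∀≡⇔ : {A : Set} {Q : A → Set} {y : A} → (∀ x → x ≡ y → Q x) ⇔ Q y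
∀≡⇔ = mk⇔ (λ f → f _ refl) (λ { q _ refl → q })

×-stable : {A B : Set} → Stable A → Stable B → Stable (A × B)
×-stable stA stB ¬¬ab = stA (λ ¬a → ¬¬ab (¬a ∘ proj₁)) , stB (λ ¬b → ¬¬ab (¬b ∘ proj₂))

does⇔ : {A : Set} (a? : Dec A) → does a? ≡ true ⇔ A
does⇔ (yes x) = mk⇔ (λ _ → x) (λ _ → refl)
does⇔ (no ¬x) = mk⇔ (λ ()) (λ x → contradiction x ¬x)

0≡m⇔0≮m : {m : ℕ} → 0 ≡ m ⇔ 0 ≮ m
0≡m⇔0≮m = mk⇔ <-irrefl (λ 0≮m → ≡.sym (n≤0⇒n≡0 (≮⇒≥ 0≮m)))

1+t≡m⇔t<m×1+t≮m : {t m : ℕ} → suc t ≡ m ⇔ (t < m × suc t ≮ m)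
1+t≡m⇔t<m×1+t≮m {t} = mk⇔ (λ { refl → n<1+n t , <-irrefl refl })
                          (λ (t<m , 1+t≮m) → ≤-antisym t<m (≮⇒≥ 1+t≮m))

prefix⇔below : {Q : ℕ → Set} (k : ℕ) → (∀ i → i < k → Q i) → (∀ j → ¬ Q (k + j)) →
               ∀ t → t < k ⇔ Q t
prefix⇔below {Q} k Q-below ¬Q-above t = mk⇔ (Q-below t) (λ Qt →
  decidable-stable (t <? k) (λ t≮k → ¬Q-above (t ∸ k) (subst Q (≡.sym (m+[n∸m]≡n (≮⇒≥ t≮k))) Qt)))

module _ {A : Set} (σ : A → ℕ → Bool) where

  var-dec : ∀ x t → Dec (σ ⊨ˡ var x at t)
  var-dec x t = σ x t Bool.≟ true

  ⊨-Xs-var : ∀ k x t → σ ⊨ˡ Xs k (var x) at t ⇔ σ x (t + k) ≡ true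
  ⊨-Xs-var zero    x t rewrite +-identityʳ t = ⇔-refl
  ⊨-Xs-var (suc k) x t rewrite +-suc t k     = ⊨-Xs-var k x (suc t)

  Xs-var-dec : ∀ k x t → Dec (σ ⊨ˡ Xs k (var x) at t)
  Xs-var-dec k x t = Dec.map (⇔-sym (⊨-Xs-var k x t)) (var-dec x (t + k))

  ⊨-⇒ : ∀ φ ψ t → Stable (σ ⊨ˡ ψ at t) →
        σ ⊨ˡ (φ ⇒ˡ ψ) at t ⇔ (σ ⊨ˡ φ at t → σ ⊨ˡ ψ at t)
  ⊨-⇒ φ ψ t stψ = mk⇔ (λ ¬[φ∧¬ψ] φt → stψ (λ ¬ψt → ¬[φ∧¬ψ] (φt , ¬ψt)))
                      (λ φ→ψ (φt , ¬ψt) → ¬ψt (φ→ψ φt))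

  ⊨-⇔ : ∀ φ ψ t → Stable (σ ⊨ˡ φ at t) → Stable (σ ⊨ˡ ψ at t) →
        σ ⊨ˡ (φ ⇔ˡ ψ) at t ⇔ (σ ⊨ˡ φ at t ⇔ σ ⊨ˡ ψ at t)
  ⊨-⇔ φ ψ t stφ stψ =
    mk⇔ (λ (φ⇒ψ , ψ⇒φ) → mk⇔ (to (⊨-⇒ φ ψ t stψ) φ⇒ψ) (to (⊨-⇒ ψ φ t stφ) ψ⇒φ))
        (λ φ⇔ψ → from (⊨-⇒ φ ψ t stψ) (to φ⇔ψ) , from (⊨-⇒ ψ φ t stφ) (from φ⇔ψ))

  ⊨-G : ∀ φ t → (∀ j → Stable (σ ⊨ˡ φ at (t + j))) →
        σ ⊨ˡ G φ at t ⇔ (∀ j → σ ⊨ˡ φ at (t + j))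
  ⊨-G φ t stφ = mk⇔ (λ Gφ j → stφ j (λ ¬φ → Gφ (j , ¬φ , λ _ _ → tt)))
                    (λ ∀φ (j , ¬φ , _) → ¬φ (∀φ j))

  ⊨-G⇒ : ∀ φ ψ → (∀ j → Stable (σ ⊨ˡ ψ at j)) →
         σ ⊨ˡ G (φ ⇒ˡ ψ) at 0 ⇔ (∀ j → σ ⊨ˡ φ at j → σ ⊨ˡ ψ at j)
  ⊨-G⇒ φ ψ stψ =
    ⇔-trans (⊨-G (φ ⇒ˡ ψ) 0 (λ _ → negated-stable)) (Π-cong-⇔ (λ j → ⊨-⇒ φ ψ j (stψ j)))

module _ {P : Set} (σ : P → ℕ → Bool) where

  ⊨ᵖ-bigAnd : (φs : List (PForm P)) → σ ⊨ᵖ bigAnd φs ⇔ All (σ ⊨ᵖ_) φs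
  ⊨ᵖ-bigAnd []           = mk⇔ (λ _ → []) (λ _ → tt)
  ⊨ᵖ-bigAnd (φ ∷ [])     = mk⇔ (_∷ []) All.head
  ⊨ᵖ-bigAnd (φ ∷ ψ ∷ φs) =
    ⇔-trans (⇔-refl ×-⇔ ⊨ᵖ-bigAnd (ψ ∷ φs)) (mk⇔ (uncurry _∷_) All.uncons)

  ⊨ᵖ-inst-iter : ∀ {d} (s : Schema P (suc d)) m ρ →
                 σ ⊨ᵖ inst (iter s) m ρ ⇔ (∀ j → j < m → σ ⊨ᵖ inst s m (extend j ρ))
  ⊨ᵖ-inst-iter s zero    ρ = mk⇔ (λ _ _ ()) (λ _ → tt)
  ⊨ᵖ-inst-iter s (suc m) ρ =
    ⇔-trans (⊨ᵖ-bigAnd (map instance-at (upTo (suc m))))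
            (mk⇔ (λ all✓ j j<m → applyUpTo⁻ id (suc m) (map⁻ all✓) j<m)
                 (λ inst✓ → map⁺ (applyUpTo⁺₁ id (suc m) (inst✓ _))))
    where
    instance-at : ℕ → PForm P
    instance-at j = inst s (suc m) (extend j ρ)

module _ {P : Set} (σ : Atom P → ℕ → Bool) where

  trBody-dec : ∀ s t → Dec (σ ⊨ˡ trBody s at t)
  trBody-dec ⊤ᵇ          t = yes tt
  trBody-dec (propI p k) t = Xs-var-dec σ k (orig p) t
  trBody-dec (¬ᵇ s)      t = ¬? (trBody-dec s t)
  trBody-dec (s ∧ᵇ u)    t = trBody-dec s t ×-dec trBody-dec u t

  inst-bodyToSchema⇔trBody : ∀ s m j →
    (σ ∘ orig) ⊨ᵖ inst (bodyToSchema s) m (extend j noVars) ⇔ σ ⊨ˡ trBody s at j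
  inst-bodyToSchema⇔trBody ⊤ᵇ          m j = ⇔-refl
  inst-bodyToSchema⇔trBody (propI p k) m j = ⇔-sym (⊨-Xs-var σ k (orig p) j)
  inst-bodyToSchema⇔trBody (¬ᵇ s)      m j = ¬-cong-⇔ (inst-bodyToSchema⇔trBody s m j)
  inst-bodyToSchema⇔trBody (s ∧ᵇ u)    m j =
    inst-bodyToSchema⇔trBody s m j ×-⇔ inst-bodyToSchema⇔trBody u m j

record Marks {P : Set} (σ : Atom P → ℕ → Bool) (m : ℕ) : Set where
  field
    below⇔a : ∀ t → t < m ⇔ σ a t ≡ true
    at⇔b    : ∀ t → t ≡ m ⇔ σ b t ≡ true

module _ {P : Set} {σ : Atom P → ℕ → Bool} {m : ℕ} (marks : Marks σ m) where
  open Marks marks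

  ⟨toSchema⟩⇔trProp : ∀ s → (σ ∘ orig) ⊨ᵖ (⟨ toSchema s ⟩ m) ⇔ σ ⊨ˡ trProp s at 0
  ⟨toSchema⟩⇔trProp ⊤ˢᵖ         = ⇔-refl
  ⟨toSchema⟩⇔trProp (propK p k) = ⇔-sym (⊨-Xs-var σ k (orig p) 0)
  ⟨toSchema⟩⇔trProp (propN p k) = begin
    σ (orig p) (m + k) ≡ true
      ∼⟨ ⇔-sym ∀≡⇔ ⟩
    (∀ j → j ≡ m → σ (orig p) (j + k) ≡ true)
      ∼⟨ Π-cong-⇔ (λ j → →-cong-⇔ (at⇔b j) (⇔-sym (⊨-Xs-var σ k (orig p) j))) ⟩
    (∀ j → σ b j ≡ true → σ ⊨ˡ Xs k (var (orig p)) at j)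
      ∼⟨ ⇔-sym (⊨-G⇒ σ (var b) (Xs k (var (orig p)))
                     (λ j → decidable-stable (Xs-var-dec σ k (orig p) j))) ⟩
    σ ⊨ˡ trProp (propN p k) at 0 ∎
  ⟨toSchema⟩⇔trProp (¬ˢᵖ s)     = ¬-cong-⇔ (⟨toSchema⟩⇔trProp s)
  ⟨toSchema⟩⇔trProp (s ∧ˢᵖ u)   = ⟨toSchema⟩⇔trProp s ×-⇔ ⟨toSchema⟩⇔trProp u
  ⟨toSchema⟩⇔trProp (bigIt s)   = begin
    (σ ∘ orig) ⊨ᵖ inst (iter (bodyToSchema s)) m noVars
      ∼⟨ ⊨ᵖ-inst-iter (σ ∘ orig) (bodyToSchema s) m noVars ⟩
    (∀ j → j < m → (σ ∘ orig) ⊨ᵖ inst (bodyToSchema s) m (extend j noVars))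
      ∼⟨ Π-cong-⇔ (λ j → →-cong-⇔ (below⇔a j) (inst-bodyToSchema⇔trBody σ s m j)) ⟩
    (∀ j → σ a j ≡ true → σ ⊨ˡ trBody s at j)
      ∼⟨ ⇔-sym (⊨-G⇒ σ (var a) (trBody s) (λ j → decidable-stable (trBody-dec σ s j))) ⟩
    σ ⊨ˡ trProp (bigIt s) at 0 ∎

-- ⌊ s ⌋ is definitionally trProp s ∧ˡ clock.
module _ {P : Set} where

  aUntilNever bAfterLastA bInitially clock : LTL (Atom P)
  aUntilNever = var a U G (¬ˡ var a)
  bAfterLastA = G ((var a ∧ˡ (¬ˡ X (var a))) ⇔ˡ X (var b))
  bInitially  = (¬ˡ var a) ⇔ˡ var b
  clock       = aUntilNever ∧ˡ (bAfterLastA ∧ˡ bInitially)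

module _ {P : Set} (σ : Atom P → ℕ → Bool) where

  ⊨-aUntilNever : σ ⊨ˡ aUntilNever at 0 ⇔ Σ ℕ (λ m → ∀ t → t < m ⇔ σ a t ≡ true)
  ⊨-aUntilNever = mk⇔
    (λ (k , never✓ , until✓) → k , prefix⇔below k until✓ (to (G¬a⇔ k) never✓))
    (λ (m , below) → m , from (G¬a⇔ m) (λ j am+j → m+n≮m m j (from (below (m + j)) am+j))
                       , λ i → to (below i))
    where
    G¬a⇔ : ∀ k → σ ⊨ˡ G (¬ˡ var a) at k ⇔ (∀ j → ¬ σ a (k + j) ≡ true)
    G¬a⇔ k = ⊨-G σ (¬ˡ var a) k (λ _ → negated-stable)

  module _ {m : ℕ} (below⇔a : ∀ t → t < m ⇔ σ a t ≡ true) where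

    ⊨-bAfterLastA : σ ⊨ˡ bAfterLastA at 0 ⇔ (∀ t → suc t ≡ m ⇔ σ b (suc t) ≡ true)
    ⊨-bAfterLastA = begin
      σ ⊨ˡ bAfterLastA at 0
        ∼⟨ ⊨-G σ last⇔b 0 (λ _ → ×-stable negated-stable negated-stable) ⟩
      (∀ t → σ ⊨ˡ last⇔b at t)
        ∼⟨ Π-cong-⇔ (λ t → ⊨-⇔ σ lastA (X (var b)) t (decidable-stable (lastA-dec t))
                                                    (decidable-stable (var-dec σ b (suc t)))) ⟩
      (∀ t → (σ a t ≡ true × ¬ σ a (suc t) ≡ true) ⇔ σ b (suc t) ≡ true)
        ∼⟨ Π-cong-⇔ (λ t → ⇔-cong (⇔-sym (last-is-m t)) ⇔-refl) ⟩
      (∀ t → suc t ≡ m ⇔ σ b (suc t) ≡ true) ∎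
      where
      lastA last⇔b : LTL (Atom P)
      lastA  = var a ∧ˡ (¬ˡ X (var a))
      last⇔b = lastA ⇔ˡ X (var b)
      lastA-dec : ∀ t → Dec (σ ⊨ˡ lastA at t)
      lastA-dec t = var-dec σ a t ×-dec ¬? (var-dec σ a (suc t))
      last-is-m : ∀ t → suc t ≡ m ⇔ (σ a t ≡ true × ¬ σ a (suc t) ≡ true)
      last-is-m t = ⇔-trans 1+t≡m⇔t<m×1+t≮m (below⇔a t ×-⇔ ¬-cong-⇔ (below⇔a (suc t)))

    ⊨-bInitially : σ ⊨ˡ bInitially at 0 ⇔ (0 ≡ m ⇔ σ b 0 ≡ true)
    ⊨-bInitially =
      ⇔-trans (⊨-⇔ σ (¬ˡ var a) (var b) 0 negated-stable (decidable-stable (var-dec σ b 0)))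
              (⇔-cong (⇔-sym (⇔-trans 0≡m⇔0≮m (¬-cong-⇔ (below⇔a 0)))) ⇔-refl)

  ⊨-clock⇔Marks : σ ⊨ˡ clock at 0 ⇔ Σ ℕ (Marks σ)
  ⊨-clock⇔Marks = mk⇔
    (λ (aUntilNever✓ , bAfterLastA✓ , bInitially✓) →
       let (m , below⇔a) = to ⊨-aUntilNever aUntilNever✓ in
       m , record { below⇔a = below⇔a
                  ; at⇔b    = λ { zero    → to (⊨-bInitially below⇔a) bInitially✓
                                ; (suc t) → to (⊨-bAfterLastA below⇔a) bAfterLastA✓ t } })
    (λ (m , marks) → let open Marks marks in
       from ⊨-aUntilNever (m , below⇔a) , from (⊨-bAfterLastA below⇔a) (at⇔b ∘ suc)
                                         , from (⊨-bInitially below⇔a) (at⇔b 0))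

marked : {P : Set} → (P → ℕ → Bool) → ℕ → Atom P → ℕ → Bool
marked σ m (orig p) = σ p
marked σ m a t      = does (t <? m)
marked σ m b t      = does (t ≟ m)

marked-Marks : {P : Set} (σ : P → ℕ → Bool) (m : ℕ) → Marks (marked σ m) m
marked-Marks σ m = record { below⇔a = λ t → ⇔-sym (does⇔ (t <? m))
                          ; at⇔b    = λ t → ⇔-sym (does⇔ (t ≟ m)) }

mainTheorem4 : {P : Set} (s : SPS P) →
    (SchemaSatisfiable (toSchema s) → LTLSatisfiable ⌊ s ⌋) ×
    (LTLSatisfiable ⌊ s ⌋ → SchemaSatisfiable (toSchema s))
mainTheorem4 s = schema⇒LTL , LTL⇒schema
  where
  schema⇒LTL : SchemaSatisfiable (toSchema s) → LTLSatisfiable ⌊ s ⌋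
  schema⇒LTL (σ , m , ⟨s⟩ₘ✓) =
    let marks = marked-Marks σ m in
    marked σ m , to (⟨toSchema⟩⇔trProp marks s) ⟨s⟩ₘ✓
               , from (⊨-clock⇔Marks (marked σ m)) (m , marks)

  LTL⇒schema : LTLSatisfiable ⌊ s ⌋ → SchemaSatisfiable (toSchema s)
  LTL⇒schema (σ , trProp✓ , clock✓) =
    let (m , marks) = to (⊨-clock⇔Marks σ) clock✓ in
    σ ∘ orig , m , from (⟨toSchema⟩⇔trProp marks s) trProp✓
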